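{- For every integer $n\geq2$ that is a power of 2, $\mathrm{spar}(\mathsf{ADDR}_n)=n^{\log 3}$.
   Context: $\mathsf{ADDR}_n:\{0,1\}^{\log n+n}\to\{0,1\}$ is $\mathsf{ADDR}_n(x,y)=y_{\mathsf{bin}(x)}$ for $x\in\{0,1\}^{\log n}$, $y\in\{0,1\}^n$, where $\mathsf{bin}(x)$ is the index in $[n]$ encoded in binary by $x$. Every Boolean function $f$ on $N$ variables has a unique real expansion $f=\sum_{S\subseteq[N]}\widetilde f(S)\prod_{i\in S}z_i$, and $\mathrm{spar}(f)$ is the number of $S$ with $\widetilde f(S)\neq0$. Logarithms base 2. -}

module Defs where

open import Data.Bool using (Bool; true; false; _∧_)
open import Data.Nat using (ℕ; zero; suc; _+_; _^_)
open import Data.Integer using (ℤ; 0ℤ; 1ℤ)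
import Data.Integer as ℤ
open import Data.Fin using (Fin; zero; suc; combine)
open import Data.Vec using (Vec; []; _∷_; lookup; take; drop; zipWith; foldr)
open import Data.List using (List; []; _∷_; map; concatMap; length; filter)
import Data.List as L
open import Relation.Nullary using (¬_)
open import Relation.Nullary.Decidable using (¬?)
open import Data.Integer.Properties using () renaming (_≟_ to _≟ℤ_)
open import Relation.Binary.PropositionalEquality using (_≡_)

BoolFun : ℕ → Set
BoolFun N = Vec Bool N → Bool

Subset : ℕ → Set
Subset N = Vec Bool N

allSubsets : (N : ℕ) → List (Subset N)
allSubsets zero = [] ∷ []
allSubsets (suc N) = concatMap (λ S → (false ∷ S) ∷ (true ∷ S) ∷ []) (allSubsets N)

-- Monomial ∏_{i∈S} z_i evaluated at z ∈ {0,1}^N.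
monomial : {N : ℕ} → Subset N → Vec Bool N → ℤ
monomial S z = if foldr _ _∧_ true (zipWith (λ s b → if s then b else true) S z) then 1ℤ else 0ℤ
  where
  if_then_else_ : {A : Set} → Bool → A → A → A
  if true then a else _ = a
  if false then _ else b = b

⟦_⟧ : Bool → ℤ
⟦ true ⟧ = 1ℤ
⟦ false ⟧ = 0ℤ

-- The real (here: integer-valued) multilinear polynomial with coefficients c, evaluated at z.
evalPoly : {N : ℕ} → (Subset N → ℤ) → Vec Bool N → ℤ
evalPoly {N} c z = L.foldr ℤ._+_ 0ℤ (map (λ S → c S ℤ.* monomial S z) (allSubsets N))

Represents : {N : ℕ} → (Subset N → ℤ) → BoolFun N → Set
Represents {N} c f = (z : Vec Bool N) → evalPoly c z ≡ ⟦ f z ⟧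

supportSize : {N : ℕ} → (Subset N → ℤ) → ℕ
supportSize {N} c = length (filter (λ S → ¬? (c S ≟ℤ 0ℤ)) (allSubsets N))

-- bin : {0,1}^k → [2^k], big-endian binary encoding (first bit most significant).
bitFin : Bool → Fin 2
bitFin false = zero
bitFin true = suc zero

bin : {k : ℕ} → Vec Bool k → Fin (2 ^ k)
bin [] = zero
bin (b ∷ x) = combine (bitFin b) (bin x)

-- ADDR_n for n = 2^k on log n + n = k + 2^k variables: ADDR(x,y) = y_{bin(x)}.
ADDR : (k : ℕ) → BoolFun (k + 2 ^ k)
ADDR k z = lookup (drop k z) (bin (take k z))

-- Expanding f in its first variable as f(z₀,z) = f(0,z) + z₀ (f(1,z) − f(0,z)) shows by induction
-- that every f : {0,1}^N → ℤ has exactly one multilinear expansion, and that its number of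
-- nonzero coefficients satisfies spar f = spar f(0,·) + spar (f(1,·) − f(0,·)).
-- Writing ADDR(x,y) = Σⱼ yⱼ [bin x = j], the monomials in y separate, so
-- spar ADDR = Σⱼ spar [bin x = j]; splitting the index j by its leading bit, the lower half
-- contributes spar [bin x = j] + spar (−[bin x = j]) and the upper half spar [bin x = j],
-- so this sum triples with every additional address bit.
module Submission where

open import Defs
open import Algebra.Bundles using (CommutativeMonoid)
open import Data.Bool using (Bool; true; false)
open import Data.Empty using (⊥-elim)
open import Data.Fin using (Fin; zero; suc; _↑ˡ_; _↑ʳ_)
open import Data.Integer using (ℤ; +_; -[1+_]; 0ℤ; 1ℤ; _-_; -_; _≟_)
  renaming (_+_ to _+ℤ_; _*_ to _*ℤ_)
import Data.Integer.Properties as ℤ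
open import Data.Integer.Tactic.RingSolver using (solve-∀)
open import Data.List using (List; []; _∷_; map; concatMap; length; filter)
import Data.List as List
open import Data.Nat using (ℕ; zero; suc; _≤_; _^_; _+_; _*_)
import Data.Nat.Properties as ℕ
open import Data.Product using (Σ; _×_; _,_)
open import Data.Vec using (Vec; []; _∷_; lookup; take; drop)
open import Function using (_∘_)
open import Relation.Nullary.Decidable using (¬?; yes; no)
open import Relation.Binary.PropositionalEquality
  using (_≡_; _≗_; refl; sym; trans; cong; cong₂; module ≡-Reasoning)

open import Algebra.Properties.CommutativeMonoid.Sum ℕ.+-0-commutativeMonoid
  using (sum; sum-syntax; ∑-distrib-+; sum-cong-≗)
open import Algebra.Properties.CommutativeSemigroup ℕ.+-commutativeSemigroup
  using (interchange)

private
  variable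
    k m n N : ℕ

module ListSum {c ℓ} (M : CommutativeMonoid c ℓ) where
  open CommutativeMonoid M
    using (Carrier; _≈_; _∙_; ε; ∙-cong; ∙-congˡ; assoc; identityˡ; setoid; commutativeSemigroup)
    renaming (refl to ≈-refl; sym to ≈-sym)
  open import Algebra.Properties.CommutativeSemigroup commutativeSemigroup
    using () renaming (interchange to ∙-interchange)
  open import Relation.Binary.Reasoning.Setoid setoid

  sumList : {A : Set} → (A → Carrier) → List A → Carrier
  sumList h xs = List.foldr _∙_ ε (map h xs)

  sumList-ε : {A : Set} (h : A → Carrier) → (∀ a → h a ≈ ε) → ∀ xs → sumList h xs ≈ ε
  sumList-ε h h≈ε []       = ≈-refl
  sumList-ε h h≈ε (a ∷ xs) = begin
    h a ∙ sumList h xs ≈⟨ ∙-cong (h≈ε a) (sumList-ε h h≈ε xs) ⟩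
    ε ∙ ε              ≈⟨ identityˡ ε ⟩
    ε                  ∎

  sumList-allSubsets-suc : (h : Subset (suc N) → Carrier) →
    sumList h (allSubsets (suc N))
      ≈ sumList (h ∘ (false ∷_)) (allSubsets N) ∙ sumList (h ∘ (true ∷_)) (allSubsets N)
  sumList-allSubsets-suc {N} h = go (allSubsets N)
    where
    h₀ h₁ : Subset N → Carrier
    h₀ = h ∘ (false ∷_)
    h₁ = h ∘ (true ∷_)
    go : ∀ Ss → sumList h (concatMap (λ S → (false ∷ S) ∷ (true ∷ S) ∷ []) Ss)
                  ≈ sumList h₀ Ss ∙ sumList h₁ Ss
    go []       = ≈-sym (identityˡ ε)
    go (S ∷ Ss) = begin
      h₀ S ∙ (h₁ S ∙ sumList h (concatMap _ Ss))    ≈⟨ ∙-congˡ (∙-congˡ (go Ss)) ⟩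
      h₀ S ∙ (h₁ S ∙ (sumList h₀ Ss ∙ sumList h₁ Ss)) ≈⟨ assoc _ _ _ ⟨
      (h₀ S ∙ h₁ S) ∙ (sumList h₀ Ss ∙ sumList h₁ Ss) ≈⟨ ∙-interchange _ _ _ _ ⟩
      (h₀ S ∙ sumList h₀ Ss) ∙ (h₁ S ∙ sumList h₁ Ss) ∎

open ListSum ℤ.+-0-commutativeMonoid using ()
  renaming (sumList to sumℤ; sumList-ε to sumℤ-0; sumList-allSubsets-suc to sumℤ-allSubsets-suc)
open ListSum ℕ.+-0-commutativeMonoid using ()
  renaming (sumList to sumℕ; sumList-allSubsets-suc to sumℕ-allSubsets-suc)

i+[j-i]≡j : ∀ i j → i +ℤ (j - i) ≡ j
i+[j-i]≡j = solve-∀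

[i+j]-i≡j : ∀ i j → (i +ℤ j) - i ≡ j
[i+j]-i≡j = solve-∀

χ≢0 : ℤ → ℕ
χ≢0 (+ 0) = 0
χ≢0 _     = 1

χ≢0-neg : ∀ a → χ≢0 (- a) ≡ χ≢0 a
χ≢0-neg (+ 0)     = refl
χ≢0-neg (+ suc _) = refl
χ≢0-neg -[1+ _ ]  = refl

supportSize≡sum : (c : Subset N → ℤ) → supportSize c ≡ sumℕ (χ≢0 ∘ c) (allSubsets N)
supportSize≡sum {N} c = go (allSubsets N)
  where
  go : ∀ Ss → length (filter (λ S → ¬? (c S ≟ 0ℤ)) Ss) ≡ sumℕ (χ≢0 ∘ c) Ss
  go []       = refl
  go (S ∷ Ss) with c S | c S ≟ 0ℤ
  ... | + 0      | yes _   = go Ss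
  ... | + 0      | no c≢0  = ⊥-elim (c≢0 refl)
  ... | + suc _  | no _    = cong suc (go Ss)
  ... | -[1+ _ ] | no _    = cong suc (go Ss)

supportSize-suc : (c : Subset (suc N) → ℤ) →
  supportSize c ≡ supportSize (c ∘ (false ∷_)) + supportSize (c ∘ (true ∷_))
supportSize-suc {N} c = begin
  supportSize c                                                         ≡⟨ supportSize≡sum c ⟩
  sumℕ (χ≢0 ∘ c) (allSubsets (suc N))                                   ≡⟨ sumℕ-allSubsets-suc (χ≢0 ∘ c) ⟩
  sumℕ (χ≢0 ∘ c ∘ (false ∷_)) (allSubsets N) + sumℕ (χ≢0 ∘ c ∘ (true ∷_)) (allSubsets N)
    ≡⟨ cong₂ _+_ (supportSize≡sum (c ∘ (false ∷_))) (supportSize≡sum (c ∘ (true ∷_))) ⟨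
  supportSize (c ∘ (false ∷_)) + supportSize (c ∘ (true ∷_))            ∎
  where open ≡-Reasoning

evalPoly-[] : (c : Subset 0 → ℤ) → evalPoly c [] ≡ c []
evalPoly-[] c = trans (ℤ.+-identityʳ _) (ℤ.*-identityʳ (c []))

evalPoly-false : (c : Subset (suc N) → ℤ) (z : Vec Bool N) →
  evalPoly c (false ∷ z) ≡ evalPoly (c ∘ (false ∷_)) z
evalPoly-false {N} c z = begin
  evalPoly c (false ∷ z)                                                  ≡⟨ sumℤ-allSubsets-suc h ⟩
  evalPoly (c ∘ (false ∷_)) z +ℤ sumℤ (λ S → c (true ∷ S) *ℤ 0ℤ) (allSubsets N)
    ≡⟨ cong (evalPoly (c ∘ (false ∷_)) z +ℤ_) (sumℤ-0 _ (ℤ.*-zeroʳ ∘ c ∘ (true ∷_)) (allSubsets N)) ⟩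
  evalPoly (c ∘ (false ∷_)) z +ℤ 0ℤ                                       ≡⟨ ℤ.+-identityʳ _ ⟩
  evalPoly (c ∘ (false ∷_)) z                                             ∎
  where
  open ≡-Reasoning
  h : Subset (suc N) → ℤ
  h S = c S *ℤ monomial S (false ∷ z)

evalPoly-true : (c : Subset (suc N) → ℤ) (z : Vec Bool N) →
  evalPoly c (true ∷ z) ≡ evalPoly (c ∘ (false ∷_)) z +ℤ evalPoly (c ∘ (true ∷_)) z
evalPoly-true c z = sumℤ-allSubsets-suc (λ S → c S *ℤ monomial S (true ∷ z))

Δ : (Vec Bool (suc N) → ℤ) → Vec Bool N → ℤ
Δ f z = f (true ∷ z) - f (false ∷ z)

coefficients : (Vec Bool N → ℤ) → Subset N → ℤ
coefficients {zero}  f S           = f []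
coefficients {suc N} f (false ∷ S) = coefficients (f ∘ (false ∷_)) S
coefficients {suc N} f (true ∷ S)  = coefficients (Δ f) S

spar : (Vec Bool N → ℤ) → ℕ
spar {zero}  f = χ≢0 (f [])
spar {suc N} f = spar (f ∘ (false ∷_)) + spar (Δ f)

evalPoly-coefficients : (f : Vec Bool N → ℤ) → evalPoly (coefficients f) ≗ f
evalPoly-coefficients {zero}  f [] = evalPoly-[] (coefficients f)
evalPoly-coefficients {suc N} f (false ∷ z) =
  trans (evalPoly-false (coefficients f) z) (evalPoly-coefficients (f ∘ (false ∷_)) z)
evalPoly-coefficients {suc N} f (true ∷ z) = begin
  evalPoly (coefficients f) (true ∷ z)                       ≡⟨ evalPoly-true (coefficients f) z ⟩
  evalPoly (coefficients (f ∘ (false ∷_))) z +ℤ evalPoly (coefficients (Δ f)) z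
    ≡⟨ cong₂ _+ℤ_ (evalPoly-coefficients (f ∘ (false ∷_)) z) (evalPoly-coefficients (Δ f) z) ⟩
  f (false ∷ z) +ℤ (f (true ∷ z) - f (false ∷ z))           ≡⟨ i+[j-i]≡j (f (false ∷ z)) (f (true ∷ z)) ⟩
  f (true ∷ z)                                               ∎
  where open ≡-Reasoning

supportSize-spar : (c : Subset N → ℤ) (f : Vec Bool N → ℤ) → evalPoly c ≗ f → supportSize c ≡ spar f
supportSize-spar {zero} c f c≗f = begin
  supportSize c   ≡⟨ supportSize≡sum c ⟩
  χ≢0 (c []) + 0  ≡⟨ ℕ.+-identityʳ _ ⟩
  χ≢0 (c [])      ≡⟨ cong χ≢0 (trans (sym (evalPoly-[] c)) (c≗f [])) ⟩
  χ≢0 (f [])      ∎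
  where open ≡-Reasoning
supportSize-spar {suc N} c f c≗f = trans (supportSize-suc c)
  (cong₂ _+_ (supportSize-spar (c ∘ (false ∷_)) (f ∘ (false ∷_)) c₀≗f₀)
             (supportSize-spar (c ∘ (true ∷_)) (Δ f) c₁≗Δf))
  where
  c₀≗f₀ : evalPoly (c ∘ (false ∷_)) ≗ f ∘ (false ∷_)
  c₀≗f₀ z = trans (sym (evalPoly-false c z)) (c≗f (false ∷ z))
  c₁≗Δf : evalPoly (c ∘ (true ∷_)) ≗ Δ f
  c₁≗Δf z = begin
    evalPoly (c ∘ (true ∷_)) z                                   ≡⟨ [i+j]-i≡j a b ⟨
    (a +ℤ b) - a                                                 ≡⟨ cong₂ _-_ (sym (evalPoly-true c z)) (sym (evalPoly-false c z)) ⟩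
    evalPoly c (true ∷ z) - evalPoly c (false ∷ z)              ≡⟨ cong₂ _-_ (c≗f (true ∷ z)) (c≗f (false ∷ z)) ⟩
    Δ f z                                                        ∎
    where
    open ≡-Reasoning
    a b : ℤ
    a = evalPoly (c ∘ (false ∷_)) z
    b = evalPoly (c ∘ (true ∷_)) z

spar-cong : {f g : Vec Bool N → ℤ} → f ≗ g → spar f ≡ spar g
spar-cong {zero}  f≗g = cong χ≢0 (f≗g [])
spar-cong {suc N} f≗g =
  cong₂ _+_ (spar-cong (f≗g ∘ (false ∷_))) (spar-cong (λ z → cong₂ _-_ (f≗g (true ∷ z)) (f≗g (false ∷ z))))

spar-const : (N : ℕ) (a : ℤ) → spar {N} (λ _ → a) ≡ χ≢0 a
spar-const zero    a = refl
spar-const (suc N) a = begin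
  spar {N} (λ _ → a) + spar {N} (λ _ → a - a)  ≡⟨ cong₂ _+_ (spar-const N a) (spar-cong {N} (λ _ → ℤ.+-inverseʳ a)) ⟩
  χ≢0 a + spar {N} (λ _ → 0ℤ)                   ≡⟨ cong (_+_ (χ≢0 a)) (spar-const N 0ℤ) ⟩
  χ≢0 a + 0                                     ≡⟨ ℕ.+-identityʳ _ ⟩
  χ≢0 a                                         ∎
  where open ≡-Reasoning

spar-neg : (f : Vec Bool N → ℤ) → spar (-_ ∘ f) ≡ spar f
spar-neg {zero}  f = χ≢0-neg (f [])
spar-neg {suc N} f = cong₂ _+_ (spar-neg (f ∘ (false ∷_)))
  (trans (spar-cong (λ z → sym (ℤ.neg-distrib-+ (f (true ∷ z)) (- f (false ∷ z))))) (spar-neg (Δ f)))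

spar₂ : (Vec Bool k → Vec Bool m → ℤ) → ℕ
spar₂ {zero}  F = spar (F [])
spar₂ {suc k} F = spar₂ (F ∘ (false ∷_)) + spar₂ (λ x y → F (true ∷ x) y - F (false ∷ x) y)

spar-take-drop : (F : Vec Bool k → Vec Bool m → ℤ) → spar (λ z → F (take k z) (drop k z)) ≡ spar₂ F
spar-take-drop {zero}  F = refl
spar-take-drop {suc k} F = cong₂ _+_ (spar-take-drop (F ∘ (false ∷_)))
  (spar-take-drop (λ x y → F (true ∷ x) y - F (false ∷ x) y))

spar₂-cong : {F G : Vec Bool k → Vec Bool m → ℤ} → (∀ x → F x ≗ G x) → spar₂ F ≡ spar₂ G
spar₂-cong {zero}  F≗G = spar-cong (F≗G [])
spar₂-cong {suc k} F≗G = cong₂ _+_ (spar₂-cong (F≗G ∘ (false ∷_)))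
  (spar₂-cong (λ x y → cong₂ _-_ (F≗G (true ∷ x) y) (F≗G (false ∷ x) y)))

spar₂-zero : spar₂ {k} {m} (λ _ _ → 0ℤ) ≡ 0
spar₂-zero {zero}  {m} = spar-const m 0ℤ
spar₂-zero {suc k}     = cong₂ _+_ (spar₂-zero {k}) (spar₂-zero {k})

b*i+j-[b*k+l] : ∀ b i j k l → (b *ℤ i +ℤ j) - (b *ℤ k +ℤ l) ≡ b *ℤ (i - k) +ℤ (j - l)
b*i+j-[b*k+l] = solve-∀

[1*i+j]-[0*i+j]≡i : ∀ i j → (1ℤ *ℤ i +ℤ j) - (0ℤ *ℤ i +ℤ j) ≡ i
[1*i+j]-[0*i+j]≡i = solve-∀

-- If F is affine in the first variable y₀ of its second block, the monomials containing y₀ are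
-- exactly those of its coefficient g, and the others are those of F at y₀ = 0.
spar₂-∷ : (F : Vec Bool k → Vec Bool (suc m) → ℤ) (g : Vec Bool k → ℤ) (H : Vec Bool k → Vec Bool m → ℤ) →
  (∀ x b y → F x (b ∷ y) ≡ ⟦ b ⟧ *ℤ g x +ℤ H x y) → spar₂ F ≡ spar g + spar₂ H
spar₂-∷ {zero} {m} F g H F≡ = begin
  spar (F [] ∘ (false ∷_)) + spar (Δ (F []))  ≡⟨ cong₂ _+_ (spar-cong F₀≗H) (spar-cong ΔF≗g) ⟩
  spar (H []) + spar {m} (λ _ → g [])         ≡⟨ cong (_+_ (spar (H []))) (spar-const m (g [])) ⟩
  spar (H []) + χ≢0 (g [])                    ≡⟨ ℕ.+-comm (spar (H [])) (χ≢0 (g [])) ⟩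
  χ≢0 (g []) + spar (H [])                    ∎
  where
  open ≡-Reasoning
  F₀≗H : F [] ∘ (false ∷_) ≗ H []
  F₀≗H y = trans (F≡ [] false y) (ℤ.+-identityˡ (H [] y))
  ΔF≗g : Δ (F []) ≗ λ _ → g []
  ΔF≗g y = trans (cong₂ _-_ (F≡ [] true y) (F≡ [] false y)) ([1*i+j]-[0*i+j]≡i (g []) (H [] y))
spar₂-∷ {suc k} F g H F≡ = begin
  spar₂ (F ∘ (false ∷_)) + spar₂ F′
    ≡⟨ cong₂ _+_ (spar₂-∷ _ (g ∘ (false ∷_)) (H ∘ (false ∷_)) (F≡ ∘ (false ∷_))) (spar₂-∷ F′ (Δ g) H′ F′≡) ⟩
  (spar (g ∘ (false ∷_)) + spar₂ (H ∘ (false ∷_))) + (spar (Δ g) + spar₂ H′)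
    ≡⟨ interchange (spar (g ∘ (false ∷_))) (spar₂ (H ∘ (false ∷_))) (spar (Δ g)) (spar₂ H′) ⟩
  spar g + spar₂ H ∎
  where
  open ≡-Reasoning
  F′ : Vec Bool k → Vec Bool (suc _) → ℤ
  F′ x y = F (true ∷ x) y - F (false ∷ x) y
  H′ : Vec Bool k → Vec Bool _ → ℤ
  H′ x y = H (true ∷ x) y - H (false ∷ x) y
  F′≡ : ∀ x b y → F′ x (b ∷ y) ≡ ⟦ b ⟧ *ℤ Δ g x +ℤ H′ x y
  F′≡ x b y = trans (cong₂ _-_ (F≡ (true ∷ x) b y) (F≡ (false ∷ x) b y))
    (b*i+j-[b*k+l] ⟦ b ⟧ (g (true ∷ x)) (H (true ∷ x) y) (g (false ∷ x)) (H (false ∷ x) y))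

linear : (Fin m → ℤ) → Vec Bool m → ℤ
linear A []      = 0ℤ
linear A (b ∷ y) = ⟦ b ⟧ *ℤ A zero +ℤ linear (A ∘ suc) y

linear-zero : (y : Vec Bool m) → linear (λ _ → 0ℤ) y ≡ 0ℤ
linear-zero []      = refl
linear-zero (b ∷ y) = cong₂ _+ℤ_ (ℤ.*-zeroʳ ⟦ b ⟧) (linear-zero y)

spar₂-linear : (A : Vec Bool k → Fin m → ℤ) → spar₂ (linear ∘ A) ≡ sum (λ j → spar (λ x → A x j))
spar₂-linear {k} {zero}  A = trans (spar₂-cong {k} (λ x → λ { [] → refl })) (spar₂-zero {k})
spar₂-linear {k} {suc m} A = trans (spar₂-∷ _ (λ x → A x zero) (λ x → linear (A x ∘ suc)) (λ x b y → refl))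
  (cong (_+_ (spar (λ x → A x zero))) (spar₂-linear (λ x → A x ∘ suc)))

δ : Fin m → Fin m → ℤ
δ zero    zero    = 1ℤ
δ zero    (suc _) = 0ℤ
δ (suc _) zero    = 0ℤ
δ (suc i) (suc j) = δ i j

⟦lookup⟧≡linear-δ : (y : Vec Bool m) (i : Fin m) → ⟦ lookup y i ⟧ ≡ linear (δ i) y
⟦lookup⟧≡linear-δ (b ∷ y) zero = sym (begin
  ⟦ b ⟧ *ℤ 1ℤ +ℤ linear (λ _ → 0ℤ) y  ≡⟨ cong₂ _+ℤ_ (ℤ.*-identityʳ ⟦ b ⟧) (linear-zero y) ⟩
  ⟦ b ⟧ +ℤ 0ℤ                         ≡⟨ ℤ.+-identityʳ ⟦ b ⟧ ⟩
  ⟦ b ⟧                               ∎)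
  where open ≡-Reasoning
⟦lookup⟧≡linear-δ (b ∷ y) (suc i) = sym (begin
  ⟦ b ⟧ *ℤ 0ℤ +ℤ linear (δ i) y  ≡⟨ cong (_+ℤ linear (δ i) y) (ℤ.*-zeroʳ ⟦ b ⟧) ⟩
  0ℤ +ℤ linear (δ i) y           ≡⟨ ℤ.+-identityˡ (linear (δ i) y) ⟩
  linear (δ i) y                 ≡⟨ ⟦lookup⟧≡linear-δ y i ⟨
  ⟦ lookup y i ⟧                 ∎)
  where open ≡-Reasoning

sum-↑ˡ-↑ʳ : (m : ℕ) (f : Fin (m + n) → ℕ) → sum f ≡ sum (f ∘ (_↑ˡ n)) + sum (f ∘ (m ↑ʳ_))
sum-↑ˡ-↑ʳ zero    f = refl
sum-↑ˡ-↑ʳ (suc m) f = trans (cong (_+_ (f zero)) (sum-↑ˡ-↑ʳ m (f ∘ suc))) (sym (ℕ.+-assoc (f zero) _ _))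

δ-↑ˡ-↑ˡ : (i j : Fin m) → δ (i ↑ˡ n) (j ↑ˡ n) ≡ δ i j
δ-↑ˡ-↑ˡ zero    zero    = refl
δ-↑ˡ-↑ˡ zero    (suc j) = refl
δ-↑ˡ-↑ˡ (suc i) zero    = refl
δ-↑ˡ-↑ˡ (suc i) (suc j) = δ-↑ˡ-↑ˡ i j

δ-↑ʳ-↑ʳ : (i j : Fin n) → δ (m ↑ʳ i) (m ↑ʳ j) ≡ δ i j
δ-↑ʳ-↑ʳ {m = zero}  i j = refl
δ-↑ʳ-↑ʳ {m = suc m} i j = δ-↑ʳ-↑ʳ {m = m} i j

δ-↑ˡ-↑ʳ : (i : Fin m) (j : Fin n) → δ (i ↑ˡ n) (m ↑ʳ j) ≡ 0ℤ
δ-↑ˡ-↑ʳ zero    j = refl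
δ-↑ˡ-↑ʳ (suc i) j = δ-↑ˡ-↑ʳ i j

δ-↑ʳ-↑ˡ : (i : Fin n) (j : Fin m) → δ (m ↑ʳ i) (j ↑ˡ n) ≡ 0ℤ
δ-↑ʳ-↑ˡ i zero    = refl
δ-↑ʳ-↑ˡ i (suc j) = δ-↑ʳ-↑ˡ i j

addressSpar : (k : ℕ) → Fin (2 ^ k) → ℕ
addressSpar k j = spar (λ x → δ (bin {k} x) j)

-- bin (b ∷ x) lies in the lower half of Fin (2 ^ suc k) iff b = false.
addressSpar-↑ˡ : (j : Fin (2 ^ k)) → addressSpar (suc k) (j ↑ˡ (2 ^ k + 0)) ≡ addressSpar k j + addressSpar k j
addressSpar-↑ˡ {k} j = cong₂ _+_ (spar-cong {k} (λ x → δ-↑ˡ-↑ˡ (bin x) j))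
  (trans (spar-cong {k} upper-δ≡-δ) (spar-neg (λ x → δ (bin {k} x) j)))
  where
  half : ℕ
  half = 2 ^ k + 0
  upper-δ≡-δ : ∀ x →
    δ (2 ^ k ↑ʳ (bin x ↑ˡ 0)) (j ↑ˡ half) - δ (bin x ↑ˡ half) (j ↑ˡ half) ≡ - δ (bin x) j
  upper-δ≡-δ x = begin
    δ (2 ^ k ↑ʳ (bin x ↑ˡ 0)) (j ↑ˡ half) - δ (bin x ↑ˡ half) (j ↑ˡ half)
      ≡⟨ cong₂ _-_ (δ-↑ʳ-↑ˡ (bin x ↑ˡ 0) j) (δ-↑ˡ-↑ˡ (bin x) j) ⟩
    0ℤ - δ (bin x) j
      ≡⟨ ℤ.+-identityˡ _ ⟩
    - δ (bin x) j
      ∎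
    where open ≡-Reasoning

addressSpar-↑ʳ : (j : Fin (2 ^ k)) → addressSpar (suc k) (2 ^ k ↑ʳ (j ↑ˡ 0)) ≡ addressSpar k j
addressSpar-↑ʳ {k} j = cong₂ _+_
  (trans (spar-cong {k} (λ x → δ-↑ˡ-↑ʳ (bin x) (j ↑ˡ 0))) (spar-const k 0ℤ))
  (spar-cong {k} upper-δ≡δ)
  where
  half : ℕ
  half = 2 ^ k + 0
  upper-δ≡δ : ∀ x →
    δ (2 ^ k ↑ʳ (bin x ↑ˡ 0)) (2 ^ k ↑ʳ (j ↑ˡ 0)) - δ (bin x ↑ˡ half) (2 ^ k ↑ʳ (j ↑ˡ 0)) ≡ δ (bin x) j
  upper-δ≡δ x = begin
    δ (2 ^ k ↑ʳ (bin x ↑ˡ 0)) (2 ^ k ↑ʳ (j ↑ˡ 0)) - δ (bin x ↑ˡ half) (2 ^ k ↑ʳ (j ↑ˡ 0))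
      ≡⟨ cong₂ _-_ (trans (δ-↑ʳ-↑ʳ {m = 2 ^ k} (bin x ↑ˡ 0) (j ↑ˡ 0)) (δ-↑ˡ-↑ˡ (bin x) j)) (δ-↑ˡ-↑ʳ (bin x) (j ↑ˡ 0)) ⟩
    δ (bin x) j - 0ℤ
      ≡⟨ ℤ.+-identityʳ _ ⟩
    δ (bin x) j
      ∎
    where open ≡-Reasoning

sum-addressSpar : (k : ℕ) → ∑[ j < 2 ^ k ] addressSpar k j ≡ 3 ^ k
sum-addressSpar zero    = refl
sum-addressSpar (suc k) = begin
  ∑[ j < 2 ^ suc k ] addressSpar (suc k) j
    ≡⟨ sum-↑ˡ-↑ʳ (2 ^ k) (addressSpar (suc k)) ⟩
  ∑[ j < 2 ^ k ] addressSpar (suc k) (j ↑ˡ (2 ^ k + 0)) + ∑[ j < 2 ^ k + 0 ] addressSpar (suc k) (2 ^ k ↑ʳ j)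
    ≡⟨ cong₂ _+_ (sum-cong-≗ (addressSpar-↑ˡ {k})) (sum-↑ˡ-↑ʳ (2 ^ k) (addressSpar (suc k) ∘ (2 ^ k ↑ʳ_))) ⟩
  ∑[ j < 2 ^ k ] (addressSpar k j + addressSpar k j) + (∑[ j < 2 ^ k ] addressSpar (suc k) (2 ^ k ↑ʳ (j ↑ˡ 0)) + 0)
    ≡⟨ cong₂ _+_ (∑-distrib-+ (addressSpar k) (addressSpar k)) (cong (_+ 0) (sum-cong-≗ (addressSpar-↑ʳ {k}))) ⟩
  (T + T) + (T + 0)
    ≡⟨ ℕ.+-assoc T T (T + 0) ⟩
  3 * T
    ≡⟨ cong (3 *_) (sum-addressSpar k) ⟩
  3 ^ suc k ∎
  where
  open ≡-Reasoning
  T : ℕ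
  T = ∑[ j < 2 ^ k ] addressSpar k j

spar-ADDR : (k : ℕ) → spar (⟦_⟧ ∘ ADDR k) ≡ 3 ^ k
spar-ADDR k = begin
  spar (⟦_⟧ ∘ ADDR k)                             ≡⟨ spar-take-drop {k} (λ x y → ⟦ lookup y (bin x) ⟧) ⟩
  spar₂ (λ x y → ⟦ lookup y (bin {k} x) ⟧)        ≡⟨ spar₂-cong {k} (λ x y → ⟦lookup⟧≡linear-δ y (bin x)) ⟩
  spar₂ (λ x → linear (δ (bin {k} x)))            ≡⟨ spar₂-linear {k} (δ ∘ bin) ⟩
  ∑[ j < 2 ^ k ] addressSpar k j                  ≡⟨ sum-addressSpar k ⟩
  3 ^ k                                           ∎
  where open ≡-Reasoning

claim17 : (k : ℕ) → 1 ≤ k →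
    Σ (Subset (k + 2 ^ k) → ℤ) (λ c → Represents c (ADDR k))
    × ((c : Subset (k + 2 ^ k) → ℤ) → Represents c (ADDR k) → supportSize c ≡ 3 ^ k)
claim17 k _ =
  (coefficients f , evalPoly-coefficients f) ,
  λ c c-represents → trans (supportSize-spar c f c-represents) (spar-ADDR k)
  where
  f : Vec Bool (k + 2 ^ k) → ℤ
  f = ⟦_⟧ ∘ ADDR k
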